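{- There exist absolute constants $c,C>0$ such that for all integers $n_1\ge n_2\ge n_3\ge n_4\ge 1$ there exist positive integers $a_1,a_2,a_3,a_4$ with $c\,n_2n_3n_4\le a_i\le C\,n_2n_3n_4$ for all $i$, such that the integers $k_1a_1+k_2a_2+k_3a_3+k_4a_4$, over all tuples $(k_1,k_2,k_3,k_4)$ with $k_i\in\mathbb{Z}\cap[-n_i,n_i]$, are pairwise distinct (distinct tuples give distinct values). Moreover, $a_1<a_2<a_3<a_4\le 2a_1$. -}

module Defs where

open import Data.Nat using (ℕ)
open import Data.Integer using (ℤ; +_; _+_; _*_; ∣_∣)
import Data.Rational as ℚ

ℕtoℚ : ℕ → ℚ.ℚ
ℕtoℚ m = (+ m) ℚ./ 1

lincomb : ℤ → ℤ → ℤ → ℤ → ℕ → ℕ → ℕ → ℕ → ℤ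
lincomb k₁ k₂ k₃ k₄ a₁ a₂ a₃ a₄ =
  k₁ * + a₁ + k₂ * + a₂ + k₃ * + a₃ + k₄ * + a₄

{-# OPTIONS --safe #-}
-- With Rᵢ = 2nᵢ + 1 and A = R₂R₃R₄ take the weights A, A + 1, A + R₂, A + R₂R₃. For
-- integers dᵢ,
--   d₁A + d₂(A + 1) + d₃(A + R₂) + d₄(A + R₂R₃) = (d₂ + R₂(d₃ + R₃d₄)) + A(d₁ + d₂ + d₃ + d₄),
-- and when |dᵢ| < Rᵢ for i ≥ 2 the first summand is a mixed-radix numeral of absolute value
-- below A. If the combination vanishes, both summands vanish, hence every "digit" dᵢ does.
-- Applied to differences of coefficients (|kᵢ - lᵢ| ≤ 2nᵢ < Rᵢ) this gives injectivity. Since nᵢ ≤ Rᵢ ≤ 3nᵢ, all weights lie in [A, 2A] and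
-- n₂n₃n₄ ≤ A ≤ 27n₂n₃n₄, so c = 1 and C = 54 work.
module Submission where

open import Defs
open import Data.Nat using (ℕ; _≤_; _<_)
open import Data.Integer using (ℤ; ∣_∣)
open import Data.Product using (Σ; ∃; _×_)
open import Relation.Binary.PropositionalEquality using (_≡_)
import Data.Nat as N
import Data.Rational as ℚ

open import Algebra.Bundles using (AbelianGroup)
open import Data.Integer using (+_; +≤+; 0ℤ; 1ℤ; -_; _+_; _-_; _*_)
open import Data.Nat using (NonZero; s≤s)
open import Data.Product using (_,_; proj₁; proj₂)
open import Relation.Binary.PropositionalEquality using (refl; sym; trans; cong; cong₂; subst; module ≡-Reasoning)
import Data.Integer.Properties as ℤ
import Data.Nat.Coprimality as Coprime
import Data.Nat.Properties as ℕ
import Data.Rational.Properties as ℚₚ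
open import Data.Integer.Tactic.RingSolver using (solve-∀)
import Data.Nat.Tactic.RingSolver as ℕ-Solver
open import Algebra.Properties.Group (AbelianGroup.group ℤ.+-0-abelianGroup)
  using (inverseˡ-unique)

ℕtoℚ≡mkℚ : ∀ m → ℕtoℚ m ≡ ℚ.mkℚ (+ m) 0 (Coprime.sym (Coprime.1-coprimeTo m))
ℕtoℚ≡mkℚ m = ℚₚ.normalize-coprime (Coprime.sym (Coprime.1-coprimeTo m))

ℕtoℚ-mono-≤ : ∀ {m n} → m ≤ n → ℕtoℚ m ℚ.≤ ℕtoℚ n
ℕtoℚ-mono-≤ {m} {n} m≤n rewrite ℕtoℚ≡mkℚ m | ℕtoℚ≡mkℚ n =
  ℚ.*≤* (ℤ.*-monoʳ-≤-nonNeg 1ℤ (+≤+ m≤n))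

ℕtoℚ-* : ∀ m n → ℕtoℚ (m N.* n) ≡ ℕtoℚ m ℚ.* ℕtoℚ n
ℕtoℚ-* m n rewrite ℕtoℚ≡mkℚ m | ℕtoℚ≡mkℚ n = ℚₚ./-cong (ℤ.pos-* m n) refl

≤⇒1*ℕtoℚ≤ℕtoℚ : ∀ {m n} → m ≤ n → ℚ.1ℚ ℚ.* ℕtoℚ m ℚ.≤ ℕtoℚ n
≤⇒1*ℕtoℚ≤ℕtoℚ {m} {n} m≤n =
  subst (ℚ._≤ ℕtoℚ n) (sym (ℚₚ.*-identityˡ (ℕtoℚ m))) (ℕtoℚ-mono-≤ m≤n)

≤*⇒ℕtoℚ≤ℕtoℚ*ℕtoℚ : ∀ {m} c n → m ≤ c N.* n → ℕtoℚ m ℚ.≤ ℕtoℚ c ℚ.* ℕtoℚ n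
≤*⇒ℕtoℚ≤ℕtoℚ*ℕtoℚ {m} c n m≤cn = subst (ℕtoℚ m ℚ.≤_) (ℕtoℚ-* c n) (ℕtoℚ-mono-≤ m≤cn)

m+R*n<R*S : ∀ {m n R S} → m < R → n < S → m N.+ R N.* n < R N.* S
m+R*n<R*S {m} {n} {R} {S} m<R n<S = begin-strict
  m N.+ R N.* n  <⟨ ℕ.+-monoˡ-< (R N.* n) m<R ⟩
  R N.+ R N.* n  ≡⟨ ℕ.*-suc R n ⟨
  R N.* N.suc n  ≤⟨ ℕ.*-monoʳ-≤ R n<S ⟩
  R N.* S        ∎
  where open ℕ.≤-Reasoning

∣i+R*j∣<R*S : ∀ {R S} i j → ∣ i ∣ < R → ∣ j ∣ < S → ∣ i + + R * j ∣ < R N.* S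
∣i+R*j∣<R*S {R} {S} i j ∣i∣<R ∣j∣<S = begin-strict
  ∣ i + + R * j ∣         ≤⟨ ℤ.∣i+j∣≤∣i∣+∣j∣ i (+ R * j) ⟩
  ∣ i ∣ N.+ ∣ + R * j ∣   ≡⟨ cong (∣ i ∣ N.+_) (ℤ.abs-* (+ R) j) ⟩
  ∣ i ∣ N.+ R N.* ∣ j ∣   <⟨ m+R*n<R*S ∣i∣<R ∣j∣<S ⟩
  R N.* S                 ∎
  where open ℕ.≤-Reasoning

i+R*j≡0⇒i≡0∧j≡0 : ∀ {R} i j → ∣ i ∣ < R → i + + R * j ≡ 0ℤ → i ≡ 0ℤ × j ≡ 0ℤ
i+R*j≡0⇒i≡0∧j≡0 {R} i j ∣i∣<R i+Rj≡0 = i≡0 , j≡0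
  where
  open ℕ.≤-Reasoning

  i≡-Rj : i ≡ - (+ R * j)
  i≡-Rj = inverseˡ-unique i (+ R * j) i+Rj≡0

  R*∣j∣<R*1 : R N.* ∣ j ∣ < R N.* 1
  R*∣j∣<R*1 = begin-strict
    R N.* ∣ j ∣      ≡⟨ ℤ.abs-* (+ R) j ⟨
    ∣ + R * j ∣      ≡⟨ ℤ.∣-i∣≡∣i∣ (+ R * j) ⟨
    ∣ - (+ R * j) ∣  ≡⟨ cong ∣_∣ i≡-Rj ⟨
    ∣ i ∣            <⟨ ∣i∣<R ⟩
    R                ≡⟨ ℕ.*-identityʳ R ⟨
    R N.* 1          ∎

  j≡0 : j ≡ 0ℤ
  j≡0 = ℤ.∣i∣≡0⇒i≡0 (ℕ.n<1⇒n≡0 (ℕ.*-cancelˡ-< R ∣ j ∣ 1 R*∣j∣<R*1))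

  i≡0 : i ≡ 0ℤ
  i≡0 = trans i≡-Rj (cong -_ (trans (cong (+ R *_) j≡0) (ℤ.*-zeroʳ (+ R))))

lincomb-sub : ∀ k₁ k₂ k₃ k₄ l₁ l₂ l₃ l₄ a₁ a₂ a₃ a₄ →
  lincomb k₁ k₂ k₃ k₄ a₁ a₂ a₃ a₄ - lincomb l₁ l₂ l₃ l₄ a₁ a₂ a₃ a₄
    ≡ lincomb (k₁ - l₁) (k₂ - l₂) (k₃ - l₃) (k₄ - l₄) a₁ a₂ a₃ a₄
lincomb-sub k₁ k₂ k₃ k₄ l₁ l₂ l₃ l₄ a₁ a₂ a₃ a₄ =
  linear k₁ k₂ k₃ k₄ l₁ l₂ l₃ l₄ (+ a₁) (+ a₂) (+ a₃) (+ a₄)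
  where
  linear : ∀ k₁ k₂ k₃ k₄ l₁ l₂ l₃ l₄ x₁ x₂ x₃ x₄ →
    (k₁ * x₁ + k₂ * x₂ + k₃ * x₃ + k₄ * x₄) - (l₁ * x₁ + l₂ * x₂ + l₃ * x₃ + l₄ * x₄)
      ≡ (k₁ - l₁) * x₁ + (k₂ - l₂) * x₂ + (k₃ - l₃) * x₃ + (k₄ - l₄) * x₄
  linear = solve-∀

module Weights (R₂ R₃ R₄ : ℕ) where

  A a₁ a₂ a₃ a₄ : ℕ
  A = R₂ N.* R₃ N.* R₄
  a₁ = A
  a₂ = A N.+ 1
  a₃ = A N.+ R₂
  a₄ = A N.+ R₂ N.* R₃

  A≤a₁ : A ≤ a₁
  A≤a₁ = ℕ.≤-refl

  A≤a₂ : A ≤ a₂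
  A≤a₂ = ℕ.m≤m+n A 1

  A≤a₃ : A ≤ a₃
  A≤a₃ = ℕ.m≤m+n A R₂

  A≤a₄ : A ≤ a₄
  A≤a₄ = ℕ.m≤m+n A (R₂ N.* R₃)

  a₁<a₂ : a₁ < a₂
  a₁<a₂ = ℕ.m<m+n A N.z<s

  a₂<a₃ : 1 < R₂ → a₂ < a₃
  a₂<a₃ = ℕ.+-monoʳ-< A

  a₃<a₄ : .{{NonZero R₂}} → 1 < R₃ → a₃ < a₄
  a₃<a₄ 1<R₃ = ℕ.+-monoʳ-< A (ℕ.m<m*n R₂ R₃ 1<R₃)

  a₄≤2a₁ : .{{NonZero R₄}} → a₄ ≤ 2 N.* a₁
  a₄≤2a₁ = ℕ.+-monoʳ-≤ A (begin
    R₂ N.* R₃         ≤⟨ ℕ.m≤m*n (R₂ N.* R₃) R₄ ⟩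
    A                 ≡⟨ ℕ.+-identityʳ A ⟨
    A N.+ 0           ∎)
    where open ℕ.≤-Reasoning

  lincomb≡digits+A*sum : ∀ d₁ d₂ d₃ d₄ →
    lincomb d₁ d₂ d₃ d₄ a₁ a₂ a₃ a₄
      ≡ (d₂ + + R₂ * (d₃ + + R₃ * d₄)) + + A * (d₁ + (d₂ + d₃ + d₄))
  lincomb≡digits+A*sum d₁ d₂ d₃ d₄ = trans
    (cong (λ x → d₁ * + A + d₂ * (+ A + 1ℤ) + d₃ * (+ A + + R₂) + d₄ * (+ A + x))
          (ℤ.pos-* R₂ R₃))
    (expand d₁ d₂ d₃ d₄ (+ A) (+ R₂) (+ R₃))
    where
    expand : ∀ d₁ d₂ d₃ d₄ α ρ₂ ρ₃ →
      d₁ * α + d₂ * (α + 1ℤ) + d₃ * (α + ρ₂) + d₄ * (α + ρ₂ * ρ₃)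
        ≡ (d₂ + ρ₂ * (d₃ + ρ₃ * d₄)) + α * (d₁ + (d₂ + d₃ + d₄))
    expand = solve-∀

  ∣digits∣<A : ∀ d₂ d₃ d₄ → ∣ d₂ ∣ < R₂ → ∣ d₃ ∣ < R₃ → ∣ d₄ ∣ < R₄ →
    ∣ d₂ + + R₂ * (d₃ + + R₃ * d₄) ∣ < A
  ∣digits∣<A d₂ d₃ d₄ ∣d₂∣<R₂ ∣d₃∣<R₃ ∣d₄∣<R₄ = ℕ.<-≤-trans
    (∣i+R*j∣<R*S d₂ _ ∣d₂∣<R₂ (∣i+R*j∣<R*S d₃ d₄ ∣d₃∣<R₃ ∣d₄∣<R₄))
    (ℕ.≤-reflexive (sym (ℕ.*-assoc R₂ R₃ R₄)))

  lincomb≡0⇒≡0 : ∀ d₁ d₂ d₃ d₄ → ∣ d₂ ∣ < R₂ → ∣ d₃ ∣ < R₃ → ∣ d₄ ∣ < R₄ →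
    lincomb d₁ d₂ d₃ d₄ a₁ a₂ a₃ a₄ ≡ 0ℤ →
    d₁ ≡ 0ℤ × d₂ ≡ 0ℤ × d₃ ≡ 0ℤ × d₄ ≡ 0ℤ
  lincomb≡0⇒≡0 d₁ d₂ d₃ d₄ ∣d₂∣<R₂ ∣d₃∣<R₃ ∣d₄∣<R₄ lincomb≡0 = d₁≡0 , d₂≡0 , d₃≡0 , d₄≡0
    where
    digits≡0∧sum≡0 : d₂ + + R₂ * (d₃ + + R₃ * d₄) ≡ 0ℤ × d₁ + (d₂ + d₃ + d₄) ≡ 0ℤ
    digits≡0∧sum≡0 = i+R*j≡0⇒i≡0∧j≡0 _ _ (∣digits∣<A d₂ d₃ d₄ ∣d₂∣<R₂ ∣d₃∣<R₃ ∣d₄∣<R₄)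
      (trans (sym (lincomb≡digits+A*sum d₁ d₂ d₃ d₄)) lincomb≡0)

    d₂≡0∧tail≡0 : d₂ ≡ 0ℤ × d₃ + + R₃ * d₄ ≡ 0ℤ
    d₂≡0∧tail≡0 = i+R*j≡0⇒i≡0∧j≡0 d₂ _ ∣d₂∣<R₂ (proj₁ digits≡0∧sum≡0)

    d₂≡0 : d₂ ≡ 0ℤ
    d₂≡0 = proj₁ d₂≡0∧tail≡0

    d₃≡0∧d₄≡0 : d₃ ≡ 0ℤ × d₄ ≡ 0ℤ
    d₃≡0∧d₄≡0 = i+R*j≡0⇒i≡0∧j≡0 d₃ d₄ ∣d₃∣<R₃ (proj₂ d₂≡0∧tail≡0)

    d₃≡0 : d₃ ≡ 0ℤ
    d₃≡0 = proj₁ d₃≡0∧d₄≡0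

    d₄≡0 : d₄ ≡ 0ℤ
    d₄≡0 = proj₂ d₃≡0∧d₄≡0

    d₁≡0 : d₁ ≡ 0ℤ
    d₁≡0 = begin
      d₁                      ≡⟨ ℤ.+-identityʳ d₁ ⟨
      d₁ + 0ℤ                 ≡⟨ cong (λ s → d₁ + s) (cong₂ _+_ (cong₂ _+_ d₂≡0 d₃≡0) d₄≡0) ⟨
      d₁ + (d₂ + d₃ + d₄)     ≡⟨ proj₂ digits≡0∧sum≡0 ⟩
      0ℤ                      ∎
      where open ≡-Reasoning

  lincomb-injective : ∀ k₁ k₂ k₃ k₄ l₁ l₂ l₃ l₄ →
    ∣ k₂ - l₂ ∣ < R₂ → ∣ k₃ - l₃ ∣ < R₃ → ∣ k₄ - l₄ ∣ < R₄ →
    lincomb k₁ k₂ k₃ k₄ a₁ a₂ a₃ a₄ ≡ lincomb l₁ l₂ l₃ l₄ a₁ a₂ a₃ a₄ →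
    k₁ ≡ l₁ × k₂ ≡ l₂ × k₃ ≡ l₃ × k₄ ≡ l₄
  lincomb-injective k₁ k₂ k₃ k₄ l₁ l₂ l₃ l₄ ∣d₂∣<R₂ ∣d₃∣<R₃ ∣d₄∣<R₄ eq =
    let d₁≡0 , d₂≡0 , d₃≡0 , d₄≡0 =
          lincomb≡0⇒≡0 (k₁ - l₁) (k₂ - l₂) (k₃ - l₃) (k₄ - l₄) ∣d₂∣<R₂ ∣d₃∣<R₃ ∣d₄∣<R₄
            (trans (sym (lincomb-sub k₁ k₂ k₃ k₄ l₁ l₂ l₃ l₄ a₁ a₂ a₃ a₄)) (ℤ.i≡j⇒i-j≡0 eq))
    in  ℤ.i-j≡0⇒i≡j k₁ l₁ d₁≡0 , ℤ.i-j≡0⇒i≡j k₂ l₂ d₂≡0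
      , ℤ.i-j≡0⇒i≡j k₃ l₃ d₃≡0 , ℤ.i-j≡0⇒i≡j k₄ l₄ d₄≡0

radix : ℕ → ℕ
radix n = N.suc (n N.+ n)

∣i-j∣<radix : ∀ {n} i j → ∣ i ∣ ≤ n → ∣ j ∣ ≤ n → ∣ i - j ∣ < radix n
∣i-j∣<radix i j ∣i∣≤n ∣j∣≤n = s≤s (ℕ.≤-trans (ℤ.∣i-j∣≤∣i∣+∣j∣ i j) (ℕ.+-mono-≤ ∣i∣≤n ∣j∣≤n))

n≤radix : ∀ n → n ≤ radix n
n≤radix n = ℕ.≤-trans (ℕ.m≤m+n n n) (ℕ.n≤1+n (n N.+ n))

1<radix : ∀ {n} → 1 ≤ n → 1 < radix n
1<radix {n} 1≤n = s≤s (ℕ.≤-trans 1≤n (ℕ.m≤m+n n n))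

radix≤3n : ∀ {n} → 1 ≤ n → radix n ≤ 3 N.* n
radix≤3n {n} 1≤n = begin
  radix n             ≤⟨ ℕ.+-monoˡ-≤ (n N.+ n) 1≤n ⟩
  n N.+ (n N.+ n)     ≡⟨ cong (λ m → n N.+ (n N.+ m)) (ℕ.+-identityʳ n) ⟨
  3 N.* n             ∎
  where open ℕ.≤-Reasoning

module Construction {n₂ n₃ n₄ : ℕ} (1≤n₄ : 1 ≤ n₄) (n₄≤n₃ : n₄ ≤ n₃) (n₃≤n₂ : n₃ ≤ n₂) where

  open Weights (radix n₂) (radix n₃) (radix n₄) public

  1≤n₃ : 1 ≤ n₃
  1≤n₃ = ℕ.≤-trans 1≤n₄ n₄≤n₃

  1≤n₂ : 1 ≤ n₂
  1≤n₂ = ℕ.≤-trans 1≤n₃ n₃≤n₂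

  increasing : a₁ < a₂ × a₂ < a₃ × a₃ < a₄ × a₄ ≤ 2 N.* a₁
  increasing = a₁<a₂ , a₂<a₃ (1<radix 1≤n₂) , a₃<a₄ (1<radix 1≤n₃) , a₄≤2a₁

  a₃≤2A : a₃ ≤ 2 N.* A
  a₃≤2A = ℕ.≤-trans (ℕ.<⇒≤ (a₃<a₄ (1<radix 1≤n₃))) a₄≤2a₁

  a₂≤2A : a₂ ≤ 2 N.* A
  a₂≤2A = ℕ.≤-trans (ℕ.<⇒≤ (a₂<a₃ (1<radix 1≤n₂))) a₃≤2A

  a₁≤2A : a₁ ≤ 2 N.* A
  a₁≤2A = ℕ.≤-trans (ℕ.<⇒≤ a₁<a₂) a₂≤2A

  n₂n₃n₄≤A : n₂ N.* n₃ N.* n₄ ≤ A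
  n₂n₃n₄≤A = ℕ.*-mono-≤ (ℕ.*-mono-≤ (n≤radix n₂) (n≤radix n₃)) (n≤radix n₄)

  2A≤54n₂n₃n₄ : 2 N.* A ≤ 54 N.* (n₂ N.* n₃ N.* n₄)
  2A≤54n₂n₃n₄ = begin
    2 N.* A
      ≤⟨ ℕ.*-monoʳ-≤ 2 (ℕ.*-mono-≤ (ℕ.*-mono-≤ (radix≤3n 1≤n₂) (radix≤3n 1≤n₃)) (radix≤3n 1≤n₄)) ⟩
    2 N.* (3 N.* n₂ N.* (3 N.* n₃) N.* (3 N.* n₄))
      ≡⟨ regroup n₂ n₃ n₄ ⟩
    54 N.* (n₂ N.* n₃ N.* n₄)
      ∎
    where
    open ℕ.≤-Reasoning
    regroup : ∀ x y z → 2 N.* (3 N.* x N.* (3 N.* y) N.* (3 N.* z)) ≡ 54 N.* (x N.* y N.* z)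
    regroup = ℕ-Solver.solve-∀

  positive : ∀ {a} → A ≤ a → 1 ≤ a
  positive = ℕ.≤-trans N.z<s

  lower : ∀ {a} → A ≤ a → ℚ.1ℚ ℚ.* ℕtoℚ (n₂ N.* n₃ N.* n₄) ℚ.≤ ℕtoℚ a
  lower A≤a = ≤⇒1*ℕtoℚ≤ℕtoℚ (ℕ.≤-trans n₂n₃n₄≤A A≤a)

  upper : ∀ {a} → a ≤ 2 N.* A → ℕtoℚ a ℚ.≤ ℕtoℚ 54 ℚ.* ℕtoℚ (n₂ N.* n₃ N.* n₄)
  upper a≤2A = ≤*⇒ℕtoℚ≤ℕtoℚ*ℕtoℚ 54 (n₂ N.* n₃ N.* n₄) (ℕ.≤-trans a≤2A 2A≤54n₂n₃n₄)

  injective : ∀ {n₁} (k₁ k₂ k₃ k₄ l₁ l₂ l₃ l₄ : ℤ) →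
    ∣ k₁ ∣ ≤ n₁ → ∣ k₂ ∣ ≤ n₂ → ∣ k₃ ∣ ≤ n₃ → ∣ k₄ ∣ ≤ n₄ →
    ∣ l₁ ∣ ≤ n₁ → ∣ l₂ ∣ ≤ n₂ → ∣ l₃ ∣ ≤ n₃ → ∣ l₄ ∣ ≤ n₄ →
    lincomb k₁ k₂ k₃ k₄ a₁ a₂ a₃ a₄ ≡ lincomb l₁ l₂ l₃ l₄ a₁ a₂ a₃ a₄ →
    k₁ ≡ l₁ × k₂ ≡ l₂ × k₃ ≡ l₃ × k₄ ≡ l₄
  injective k₁ k₂ k₃ k₄ l₁ l₂ l₃ l₄ _ ∣k₂∣≤n₂ ∣k₃∣≤n₃ ∣k₄∣≤n₄ _ ∣l₂∣≤n₂ ∣l₃∣≤n₃ ∣l₄∣≤n₄ =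
    lincomb-injective k₁ k₂ k₃ k₄ l₁ l₂ l₃ l₄
      (∣i-j∣<radix k₂ l₂ ∣k₂∣≤n₂ ∣l₂∣≤n₂)
      (∣i-j∣<radix k₃ l₃ ∣k₃∣≤n₃ ∣l₃∣≤n₃)
      (∣i-j∣<radix k₄ l₄ ∣k₄∣≤n₄ ∣l₄∣≤n₄)

lemma5p8 : Σ ℚ.ℚ λ c → Σ ℚ.ℚ λ C → ℚ.Positive c × ℚ.Positive C ×
    ((n₁ n₂ n₃ n₄ : ℕ) → 1 ≤ n₄ → n₄ ≤ n₃ → n₃ ≤ n₂ → n₂ ≤ n₁ →
      Σ ℕ λ a₁ → Σ ℕ λ a₂ → Σ ℕ λ a₃ → Σ ℕ λ a₄ →
        (1 ≤ a₁ × 1 ≤ a₂ × 1 ≤ a₃ × 1 ≤ a₄)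
        × (c ℚ.* ℕtoℚ (n₂ N.* n₃ N.* n₄) ℚ.≤ ℕtoℚ a₁
           × c ℚ.* ℕtoℚ (n₂ N.* n₃ N.* n₄) ℚ.≤ ℕtoℚ a₂
           × c ℚ.* ℕtoℚ (n₂ N.* n₃ N.* n₄) ℚ.≤ ℕtoℚ a₃
           × c ℚ.* ℕtoℚ (n₂ N.* n₃ N.* n₄) ℚ.≤ ℕtoℚ a₄)
        × (ℕtoℚ a₁ ℚ.≤ C ℚ.* ℕtoℚ (n₂ N.* n₃ N.* n₄)
           × ℕtoℚ a₂ ℚ.≤ C ℚ.* ℕtoℚ (n₂ N.* n₃ N.* n₄)
           × ℕtoℚ a₃ ℚ.≤ C ℚ.* ℕtoℚ (n₂ N.* n₃ N.* n₄)
           × ℕtoℚ a₄ ℚ.≤ C ℚ.* ℕtoℚ (n₂ N.* n₃ N.* n₄))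
        × ((k₁ k₂ k₃ k₄ l₁ l₂ l₃ l₄ : ℤ) →
            ∣ k₁ ∣ ≤ n₁ → ∣ k₂ ∣ ≤ n₂ → ∣ k₃ ∣ ≤ n₃ → ∣ k₄ ∣ ≤ n₄ →
            ∣ l₁ ∣ ≤ n₁ → ∣ l₂ ∣ ≤ n₂ → ∣ l₃ ∣ ≤ n₃ → ∣ l₄ ∣ ≤ n₄ →
            lincomb k₁ k₂ k₃ k₄ a₁ a₂ a₃ a₄ ≡ lincomb l₁ l₂ l₃ l₄ a₁ a₂ a₃ a₄ →
            (k₁ ≡ l₁ × k₂ ≡ l₂ × k₃ ≡ l₃ × k₄ ≡ l₄))
        × (a₁ < a₂ × a₂ < a₃ × a₃ < a₄ × a₄ ≤ 2 N.* a₁))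
lemma5p8 = ℚ.1ℚ , ℕtoℚ 54 , _ , _ , λ _ _ _ _ 1≤n₄ n₄≤n₃ n₃≤n₂ _ →
  let open Construction 1≤n₄ n₄≤n₃ n₃≤n₂ in
  a₁ , a₂ , a₃ , a₄
  , (positive A≤a₁ , positive A≤a₂ , positive A≤a₃ , positive A≤a₄)
  , (lower A≤a₁ , lower A≤a₂ , lower A≤a₃ , lower A≤a₄)
  , (upper a₁≤2A , upper a₂≤2A , upper a₃≤2A , upper a₄≤2a₁)
  , injective
  , increasing
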